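{- Let $S$ be a stable cut in an unweighted graph $G=(V,E)$ that has a unique critical vertex $u$, with $u\in S$. Let $w\notin S$ be a vertex with $x_S(w)=0$. Then $\varphi(S\oplus w)\ge\varphi(S)$.
   Context: For a cut $S\subseteq V$: $C_S$ is the number of edges crossing $S$; $d(v)$ the degree, $d_S(v)$ the number of crossing edges at $v$, and $x_S(v)=d_S(v)-d(v)/2$ the excess. $S$ is stable if $d_S(v)>(d(v)-1)/2$ for all $v$. $S\oplus w$ is $S\setminus\{w\}$ if $w\in S$ and $S\cup\{w\}$ otherwise. $\varphi(S)=\min_{v\in V}C_{S-\{v\},G-\{v\}}$, where $G-\{v\}$ deletes $v$ and incident edges; $v$ is critical for $S$ if $C_{S-\{v\},G-\{v\}}=\varphi(S)$. -}

module Defs where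

open import Data.Nat using (ℕ; zero; suc; _+_; _*_; _⊓_; _<_)
open import Data.Bool using (Bool; true; false; if_then_else_; _∧_; not; _xor_)
open import Data.Fin using (Fin; toℕ; _≟_)
open import Data.Fin as F using ()
open import Data.List using (List; foldr; map)
open import Data.Nat.ListAction using (sum)
open import Data.List.Base using (allFin)
open import Data.Nat using (_<ᵇ_)
open import Relation.Nullary.Decidable using (⌊_⌋)
open import Relation.Binary.PropositionalEquality using (_≡_)

record Graph (n : ℕ) : Set where
  field
    adj   : Fin n → Fin n → Bool
    sym   : ∀ i j → adj i j ≡ adj j i
    loopless : ∀ i → adj i i ≡ false
open Graph public

-- A cut S ⊆ V, given by its characteristic function (true = in S).
Cut : ℕ → Set
Cut n = Fin n → Bool

count : ∀ {n} → (Fin n → Bool) → ℕ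
count {n} p = sum (map (λ i → if p i then 1 else 0) (allFin n))

crosses : ∀ {n} → Graph n → Cut n → Fin n → Fin n → Bool
crosses G S i j = adj G i j ∧ (S i xor S j)

C : ∀ {n} → Graph n → Cut n → ℕ
C G S = sum (map (λ i → count (λ j → (toℕ i <ᵇ toℕ j) ∧ crosses G S i j)) (allFin _))

deg : ∀ {n} → Graph n → Fin n → ℕ
deg G v = count (λ j → adj G v j)

degS : ∀ {n} → Graph n → Cut n → Fin n → ℕ
degS G S v = count (λ j → crosses G S v j)

-- S is stable: d_S(v) > (d(v) - 1)/2 for all v, i.e. (multiplying by 2) d(v) < 2 d_S(v) + 1
Stable : ∀ {n} → Graph n → Cut n → Set
Stable G S = ∀ v → deg G v < 2 * degS G S v + 1

-- excess x_S(v) = d_S(v) - d(v)/2 is zero, i.e. 2 d_S(v) = d(v)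
ExcessZero : ∀ {n} → Graph n → Cut n → Fin n → Set
ExcessZero G S v = 2 * degS G S v ≡ deg G v

-- C_{S - {v}, G - {v}}: edges of G not incident to v crossing S (membership of v irrelevant)
Cdel : ∀ {n} → Graph n → Cut n → Fin n → ℕ
Cdel G S v = sum (map (λ i → count (λ j →
    not ⌊ i ≟ v ⌋ ∧ not ⌊ j ≟ v ⌋ ∧ (toℕ i <ᵇ toℕ j) ∧ crosses G S i j)) (allFin _))

φ : ∀ {n} → Graph (suc n) → Cut (suc n) → ℕ
φ G S = foldr (λ v acc → Cdel G S v ⊓ acc) (Cdel G S F.zero) (allFin _)

Critical : ∀ {n} → Graph (suc n) → Cut (suc n) → Fin (suc n) → Set
Critical G S v = Cdel G S v ≡ φ G S

_⊕_ : ∀ {n} → Cut n → Fin n → Cut n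
(S ⊕ w) v = if ⌊ v ≟ w ⌋ then not (S v) else S v

-- Deleting a vertex v removes exactly the crossing edges at v, so the deletion value
-- C_{S-{v},G-{v}} equals C_S − d_S(v). As x_S(w) = 0, moving w to the other side keeps
-- d_S(w) crossing edges at w, hence C_{S⊕w} = C_S. The deletion value at w ignores the side
-- of w. Any other vertex v gains at most the crossing edge vw, so its deletion value drops by
-- at most one, and not at all for v = u, since uw stops crossing. Finally every v ∉ {u, w} is
-- non-critical for S, so its deletion value was at least φ(S) + 1.
module Submission where

open import Defs
open import Data.Nat using (ℕ; suc; _≥_)
open import Data.Fin using (Fin)
open import Data.Bool using (true; false)
open import Relation.Binary.PropositionalEquality using (_≡_)

open import Data.Bool using (Bool; if_then_else_; _∧_; _xor_; not)
open import Data.Bool.Properties using (T-≡; ¬-not; ∧-zeroʳ; xor-comm; xor-same; not-distribˡ-xor)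
open import Data.Fin using (toℕ; _≟_)
open import Data.Fin as Fin using (zero)
open import Data.Fin.Properties using (<-cmp; punchInᵢ≢i)
open import Data.Vec.Functional using (removeAt)
open import Data.List using ([]; _∷_; foldr; map; tabulate; allFin)
open import Data.List.Membership.Propositional using (_∈_)
open import Data.List.Membership.Propositional.Properties using (∈-allFin)
open import Data.List.Properties using (map-cong; map-tabulate)
open import Data.List.Relation.Unary.Any using (here; there)
open import Data.Nat using (_+_; _≤_; _<_; _⊓_; _<ᵇ_; z≤n)
import Data.Nat.ListAction as List
open import Data.Nat.Properties
  using ( +-0-commutativeMonoid; +-identityʳ; +-assoc; +-comm; +-cancelʳ-≡; +-cancelʳ-≤
        ; +-mono-≤; +-monoʳ-≤; ≤-refl; ≤-reflexive; ≤-trans; m≤n+m; m<1+n⇒m≤n; ≤∧≢⇒<; <-irrefl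
        ; ⊓-glb; m⊓n≤m; m⊓n≤n; <ᵇ⇒<; <⇒<ᵇ; module ≤-Reasoning)
open import Algebra.Properties.CommutativeMonoid.Sum +-0-commutativeMonoid
  using (sum; sum-syntax; sum-cong-≗; ∑-distrib-+; sum-replicate-zero; sum-remove)
open import Function using (_∘_; id; case_of_; Equivalence)
open import Relation.Binary using (tri<; tri≈; tri>)
open import Relation.Binary.PropositionalEquality as ≡ using (_≢_; refl; trans; cong; cong₂; module ≡-Reasoning)
open import Relation.Nullary using (¬_; yes; no)
open import Relation.Nullary.Decidable using (⌊_⌋; isYes≗does; dec-true; dec-false)

𝟙 : Bool → ℕ
𝟙 b = if b then 1 else 0

𝟙-∧-not-+-𝟙-∧ : ∀ a b → 𝟙 (a ∧ not b) + 𝟙 (a ∧ b) ≡ 𝟙 a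
𝟙-∧-not-+-𝟙-∧ false b = refl
𝟙-∧-not-+-𝟙-∧ true false = refl
𝟙-∧-not-+-𝟙-∧ true true = refl

𝟙≤1 : ∀ b → 𝟙 b ≤ 1
𝟙≤1 false = z≤n
𝟙≤1 true = ≤-refl

single : ∀ {m} → Fin m → ℕ → Fin m → ℕ
single v x i = if ⌊ i ≟ v ⌋ then x else 0

⌊≟⌋-refl : ∀ {m} (v : Fin m) → ⌊ v ≟ v ⌋ ≡ true
⌊≟⌋-refl v = trans (isYes≗does (v ≟ v)) (dec-true (v ≟ v) refl)

⌊≟⌋-≢ : ∀ {m} {i v : Fin m} → i ≢ v → ⌊ i ≟ v ⌋ ≡ false
⌊≟⌋-≢ {i = i} {v} i≢v = trans (isYes≗does (i ≟ v)) (dec-false (i ≟ v) i≢v)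

single-≡ : ∀ {m} (v : Fin m) x → single v x v ≡ x
single-≡ v x = cong (if_then x else 0) (⌊≟⌋-refl v)

single-≢ : ∀ {m} {v i : Fin m} x → i ≢ v → single v x i ≡ 0
single-≢ x i≢v = cong (if_then x else 0) (⌊≟⌋-≢ i≢v)

∑-single : ∀ {m} (v : Fin m) x → ∑[ i < m ] single v x i ≡ x
∑-single {suc m} v x = begin
  sum (single v x)                                 ≡⟨ sum-remove {i = v} (single v x) ⟩
  single v x v + sum (removeAt (single v x) v)     ≡⟨ cong₂ _+_ (single-≡ v x) rest≡0 ⟩
  x + 0                                            ≡⟨ +-identityʳ x ⟩
  x                                                ∎
  where
  open ≡-Reasoning
  rest≡0 : sum (removeAt (single v x) v) ≡ 0
  rest≡0 = trans (sum-cong-≗ (single-≢ x ∘ punchInᵢ≢i v)) (sum-replicate-zero m)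

∑-mono-≤ : ∀ {m} {f g : Fin m → ℕ} → (∀ i → f i ≤ g i) → ∑[ i < m ] f i ≤ ∑[ i < m ] g i
∑-mono-≤ {0} f≤g = z≤n
∑-mono-≤ {suc m} f≤g = +-mono-≤ (f≤g zero) (∑-mono-≤ (f≤g ∘ Fin.suc))

∑-without : ∀ {m} (v : Fin m) (p : Fin m → Bool) →
            ∑[ j < m ] 𝟙 (p j) ≡ ∑[ j < m ] 𝟙 (not ⌊ j ≟ v ⌋ ∧ p j) + 𝟙 (p v)
∑-without {m} v p = begin
  ∑[ j < m ] 𝟙 (p j)                             ≡⟨ sum-cong-≗ split ⟩
  ∑[ j < m ] (others j + single v (𝟙 (p v)) j)   ≡⟨ ∑-distrib-+ others (single v (𝟙 (p v))) ⟩
  sum others + ∑[ j < m ] single v (𝟙 (p v)) j   ≡⟨ cong (sum others +_) (∑-single v (𝟙 (p v))) ⟩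
  sum others + 𝟙 (p v)                           ∎
  where
  open ≡-Reasoning
  others : Fin m → ℕ
  others j = 𝟙 (not ⌊ j ≟ v ⌋ ∧ p j)
  split : ∀ j → 𝟙 (p j) ≡ others j + single v (𝟙 (p v)) j
  split j with j ≟ v
  ... | yes refl = refl
  ... | no _ = ≡.sym (+-identityʳ _)

sum-tabulate : ∀ {m} (f : Fin m → ℕ) → List.sum (tabulate f) ≡ ∑[ i < m ] f i
sum-tabulate {0} f = refl
sum-tabulate {suc m} f = cong (f zero +_) (sum-tabulate (f ∘ Fin.suc))

sum-map-allFin : ∀ {m} (f : Fin m → ℕ) → List.sum (map f (allFin m)) ≡ ∑[ i < m ] f i
sum-map-allFin f = trans (cong List.sum (map-tabulate id f)) (sum-tabulate f)

count-≡-∑ : ∀ {m} (p : Fin m → Bool) → count p ≡ ∑[ i < m ] 𝟙 (p i)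
count-≡-∑ p = sum-map-allFin (𝟙 ∘ p)

count-cong : ∀ {m} {p q : Fin m → Bool} → (∀ i → p i ≡ q i) → count p ≡ count q
count-cong {m} p≗q = cong List.sum (map-cong (cong 𝟙 ∘ p≗q) (allFin m))

count-≤-+ : ∀ {m} {p q : Fin m → Bool} (w : Fin m) →
            (∀ j → j ≢ w → p j ≡ q j) → count p ≤ count q + 𝟙 (p w)
count-≤-+ {m} {p} {q} w p≡q = begin
  count p                                                ≡⟨ count-≡-∑ p ⟩
  ∑[ j < m ] 𝟙 (p j)                                     ≤⟨ ∑-mono-≤ bound ⟩
  ∑[ j < m ] (𝟙 (q j) + single w (𝟙 (p w)) j)           ≡⟨ ∑-distrib-+ (𝟙 ∘ q) (single w (𝟙 (p w))) ⟩
  ∑[ j < m ] 𝟙 (q j) + ∑[ j < m ] single w (𝟙 (p w)) j  ≡⟨ cong₂ _+_ (≡.sym (count-≡-∑ q)) (∑-single w _) ⟩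
  count q + 𝟙 (p w)                                      ∎
  where
  open ≤-Reasoning
  bound : ∀ j → 𝟙 (p j) ≤ 𝟙 (q j) + single w (𝟙 (p w)) j
  bound j with j ≟ w
  ... | yes refl = m≤n+m _ _
  ... | no j≢w = ≤-reflexive (trans (cong 𝟙 (p≡q j j≢w)) (≡.sym (+-identityʳ _)))

<ᵇ-true : ∀ {m n} → m < n → (m <ᵇ n) ≡ true
<ᵇ-true = Equivalence.to T-≡ ∘ <⇒<ᵇ

<ᵇ-false : ∀ {m n} → ¬ m < n → (m <ᵇ n) ≡ false
<ᵇ-false {m} {n} m≮n = ¬-not (m≮n ∘ <ᵇ⇒< m n ∘ Equivalence.from T-≡)

module _ {m} (G : Graph m) (S : Cut m) where

  crosses-sym : ∀ i j → crosses G S i j ≡ crosses G S j i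
  crosses-sym i j = cong₂ _∧_ (Graph.sym G i j) (xor-comm (S i) (S j))

  crosses-irrefl : ∀ i → crosses G S i i ≡ false
  crosses-irrefl i = cong (_∧ (S i xor S i)) (loopless G i)

  crosses< : Fin m → Fin m → Bool
  crosses< i j = (toℕ i <ᵇ toℕ j) ∧ crosses G S i j

  crosses<-irrefl : ∀ i → crosses< i i ≡ false
  crosses<-irrefl i = cong (_∧ crosses G S i i) (<ᵇ-false {toℕ i} (<-irrefl refl))

  crosses-split : ∀ v j → 𝟙 (crosses G S v j) ≡ 𝟙 (crosses< v j) + 𝟙 (crosses< j v)
  crosses-split v j with <-cmp v j
  ... | tri< v<j _ j≮v rewrite <ᵇ-true v<j | <ᵇ-false j≮v = ≡.sym (+-identityʳ _)
  ... | tri≈ _ refl _ rewrite crosses<-irrefl v | crosses-irrefl v = refl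
  ... | tri> v≮j _ j<v rewrite <ᵇ-false v≮j | <ᵇ-true j<v = cong 𝟙 (crosses-sym v j)

  row : Fin m → ℕ
  row i = ∑[ j < m ] 𝟙 (crosses< i j)

  crosses<-avoiding : Fin m → Fin m → Fin m → Bool
  crosses<-avoiding v i j = not ⌊ i ≟ v ⌋ ∧ not ⌊ j ≟ v ⌋ ∧ crosses< i j

  rowAvoiding : Fin m → Fin m → ℕ
  rowAvoiding v i = ∑[ j < m ] 𝟙 (crosses<-avoiding v i j)

  row-split : ∀ v i → row i ≡ rowAvoiding v i + single v (row v) i + 𝟙 (crosses< i v)
  row-split v i with i ≟ v
  ... | yes refl = ≡.sym (begin
    ∑[ j < m ] 0 + row i + 𝟙 (crosses< i i)
      ≡⟨ cong₂ (λ a b → a + row i + 𝟙 b) (sum-replicate-zero m) (crosses<-irrefl i) ⟩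
    row i + 0                                ≡⟨ +-identityʳ _ ⟩
    row i                                    ∎)
    where open ≡-Reasoning
  ... | no _ = trans (∑-without v (crosses< i)) (cong (_+ 𝟙 (crosses< i v)) (≡.sym (+-identityʳ _)))

  C-≡-∑-row : C G S ≡ ∑[ i < m ] row i
  C-≡-∑-row = trans (sum-map-allFin (count ∘ crosses<)) (sum-cong-≗ (count-≡-∑ ∘ crosses<))

  Cdel-≡-∑-rowAvoiding : ∀ v → Cdel G S v ≡ ∑[ i < m ] rowAvoiding v i
  Cdel-≡-∑-rowAvoiding v =
    trans (sum-map-allFin (count ∘ crosses<-avoiding v)) (sum-cong-≗ (count-≡-∑ ∘ crosses<-avoiding v))

  degS-≡-row : ∀ v → degS G S v ≡ row v + ∑[ i < m ] 𝟙 (crosses< i v)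
  degS-≡-row v = begin
    degS G S v                                                ≡⟨ count-≡-∑ (crosses G S v) ⟩
    ∑[ j < m ] 𝟙 (crosses G S v j)                            ≡⟨ sum-cong-≗ (crosses-split v) ⟩
    ∑[ j < m ] (𝟙 (crosses< v j) + 𝟙 (crosses< j v))          ≡⟨ ∑-distrib-+ (𝟙 ∘ crosses< v) (λ j → 𝟙 (crosses< j v)) ⟩
    row v + ∑[ j < m ] 𝟙 (crosses< j v)                       ∎
    where open ≡-Reasoning

  Cdel-+-degS : ∀ v → Cdel G S v + degS G S v ≡ C G S
  Cdel-+-degS v = begin
    Cdel G S v + degS G S v           ≡⟨ cong₂ _+_ (Cdel-≡-∑-rowAvoiding v) (degS-≡-row v) ⟩
    ∑A + (row v + ∑B)                 ≡⟨ ≡.sym (+-assoc ∑A (row v) ∑B) ⟩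
    ∑A + row v + ∑B                   ≡⟨ cong (λ x → ∑A + x + ∑B) (≡.sym (∑-single v (row v))) ⟩
    ∑A + ∑[ i < m ] single v (row v) i + ∑B
      ≡⟨ cong (_+ ∑B) (≡.sym (∑-distrib-+ (rowAvoiding v) (single v (row v)))) ⟩
    ∑[ i < m ] (rowAvoiding v i + single v (row v) i) + ∑B
      ≡⟨ ≡.sym (∑-distrib-+ (λ i → rowAvoiding v i + single v (row v) i) (λ i → 𝟙 (crosses< i v))) ⟩
    ∑[ i < m ] (rowAvoiding v i + single v (row v) i + 𝟙 (crosses< i v))
      ≡⟨ ≡.sym (sum-cong-≗ (row-split v)) ⟩
    ∑[ i < m ] row i                  ≡⟨ ≡.sym C-≡-∑-row ⟩
    C G S                             ∎
    where
    open ≡-Reasoning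
    ∑A ∑B : ℕ
    ∑A = ∑[ i < m ] rowAvoiding v i
    ∑B = ∑[ i < m ] 𝟙 (crosses< i v)

Cdel-≤-Cdel-+ : ∀ {m} (G : Graph m) {S T : Cut m} v k →
                C G T ≡ C G S → degS G T v ≤ degS G S v + k → Cdel G S v ≤ Cdel G T v + k
Cdel-≤-Cdel-+ G {S} {T} v k CT≡CS degT≤ = +-cancelʳ-≤ (degS G S v) _ _ (begin
  Cdel G S v + degS G S v        ≡⟨ Cdel-+-degS G S v ⟩
  C G S                          ≡⟨ ≡.sym CT≡CS ⟩
  C G T                          ≡⟨ ≡.sym (Cdel-+-degS G T v) ⟩
  Cdel G T v + degS G T v        ≤⟨ +-monoʳ-≤ (Cdel G T v) degT≤ ⟩
  Cdel G T v + (degS G S v + k)  ≡⟨ cong (Cdel G T v +_) (+-comm (degS G S v) k) ⟩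
  Cdel G T v + (k + degS G S v)  ≡⟨ ≡.sym (+-assoc (Cdel G T v) k (degS G S v)) ⟩
  Cdel G T v + k + degS G S v    ∎)
  where open ≤-Reasoning

Cdel-cong : ∀ {m} (G : Graph m) {S T : Cut m} v →
            (∀ i → i ≢ v → S i ≡ T i) → Cdel G S v ≡ Cdel G T v
Cdel-cong {m} G {S} {T} v S≗T = cong List.sum (map-cong (λ i → count-cong (agree i)) (allFin m))
  where
  agree : ∀ i j → crosses<-avoiding G S v i j ≡ crosses<-avoiding G T v i j
  agree i j with i ≟ v | j ≟ v
  ... | yes _ | _ = refl
  ... | no _ | yes _ = refl
  ... | no i≢v | no j≢v =
    cong (λ b → (toℕ i <ᵇ toℕ j) ∧ adj G i j ∧ b) (cong₂ _xor_ (S≗T i i≢v) (S≗T j j≢v))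

⊕-self : ∀ {m} (S : Cut m) w → (S ⊕ w) w ≡ not (S w)
⊕-self S w = cong (if_then not (S w) else S w) (⌊≟⌋-refl w)

⊕-≢ : ∀ {m} (S : Cut m) {w i} → i ≢ w → (S ⊕ w) i ≡ S i
⊕-≢ S {i = i} i≢w = cong (if_then not (S i) else S i) (⌊≟⌋-≢ i≢w)

module _ {m} (G : Graph m) (S : Cut m) (w : Fin m) where

  Cdel-⊕-self : Cdel G (S ⊕ w) w ≡ Cdel G S w
  Cdel-⊕-self = Cdel-cong G w (λ _ → ⊕-≢ S)

  crosses-⊕-self : ∀ {j} → j ≢ w → crosses G (S ⊕ w) w j ≡ adj G w j ∧ not (S w xor S j)
  crosses-⊕-self {j} j≢w = cong (adj G w j ∧_)
    (trans (cong₂ _xor_ (⊕-self S w) (⊕-≢ S j≢w)) (≡.sym (not-distribˡ-xor (S w) (S j))))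

  degS-⊕-self-+-degS : degS G (S ⊕ w) w + degS G S w ≡ deg G w
  degS-⊕-self-+-degS = begin
    degS G (S ⊕ w) w + degS G S w
      ≡⟨ cong₂ _+_ (count-≡-∑ (crosses G (S ⊕ w) w)) (count-≡-∑ (crosses G S w)) ⟩
    ∑[ j < m ] 𝟙 (crosses G (S ⊕ w) w j) + ∑[ j < m ] 𝟙 (crosses G S w j)
      ≡⟨ ≡.sym (∑-distrib-+ (𝟙 ∘ crosses G (S ⊕ w) w) (𝟙 ∘ crosses G S w)) ⟩
    ∑[ j < m ] (𝟙 (crosses G (S ⊕ w) w j) + 𝟙 (crosses G S w j))
      ≡⟨ sum-cong-≗ pointwise ⟩
    ∑[ j < m ] 𝟙 (adj G w j)
      ≡⟨ ≡.sym (count-≡-∑ (adj G w)) ⟩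
    deg G w ∎
    where
    open ≡-Reasoning
    pointwise : ∀ j → 𝟙 (crosses G (S ⊕ w) w j) + 𝟙 (crosses G S w j) ≡ 𝟙 (adj G w j)
    pointwise j = case j ≟ w of λ where
      (yes refl) → trans (cong₂ (λ a b → 𝟙 a + 𝟙 b) (crosses-irrefl G (S ⊕ w) w) (crosses-irrefl G S w))
                         (cong 𝟙 (≡.sym (loopless G w)))
      (no j≢w) → trans (cong (λ b → 𝟙 b + 𝟙 (crosses G S w j)) (crosses-⊕-self j≢w))
                       (𝟙-∧-not-+-𝟙-∧ (adj G w j) (S w xor S j))

  degS-⊕-self : ExcessZero G S w → degS G (S ⊕ w) w ≡ degS G S w
  degS-⊕-self balanced = +-cancelʳ-≡ (degS G S w) _ _ (begin
    degS G (S ⊕ w) w + degS G S w  ≡⟨ degS-⊕-self-+-degS ⟩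
    deg G w                        ≡⟨ ≡.sym balanced ⟩
    degS G S w + (degS G S w + 0)  ≡⟨ cong (degS G S w +_) (+-identityʳ _) ⟩
    degS G S w + degS G S w        ∎)
    where open ≡-Reasoning

  C-⊕ : ExcessZero G S w → C G (S ⊕ w) ≡ C G S
  C-⊕ balanced = begin
    C G (S ⊕ w)                          ≡⟨ ≡.sym (Cdel-+-degS G (S ⊕ w) w) ⟩
    Cdel G (S ⊕ w) w + degS G (S ⊕ w) w  ≡⟨ cong₂ _+_ Cdel-⊕-self (degS-⊕-self balanced) ⟩
    Cdel G S w + degS G S w              ≡⟨ Cdel-+-degS G S w ⟩
    C G S                                ∎
    where open ≡-Reasoning

  degS-⊕-≤ : ∀ {v} → v ≢ w → degS G (S ⊕ w) v ≤ degS G S v + 𝟙 (crosses G (S ⊕ w) v w)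
  degS-⊕-≤ {v} v≢w = count-≤-+ w λ j j≢w →
    cong (adj G v j ∧_) (cong₂ _xor_ (⊕-≢ S v≢w) (⊕-≢ S j≢w))

  crosses-⊕-opposite : ∀ {v} → v ≢ w → S v ≡ not (S w) → crosses G (S ⊕ w) v w ≡ false
  crosses-⊕-opposite {v} v≢w opposite = begin
    adj G v w ∧ ((S ⊕ w) v xor (S ⊕ w) w)
      ≡⟨ cong (adj G v w ∧_) (cong₂ _xor_ (trans (⊕-≢ S v≢w) opposite) (⊕-self S w)) ⟩
    adj G v w ∧ (not (S w) xor not (S w))  ≡⟨ cong (adj G v w ∧_) (xor-same (not (S w))) ⟩
    adj G v w ∧ false                      ≡⟨ ∧-zeroʳ (adj G v w) ⟩
    false                                  ∎
    where open ≡-Reasoning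

foldr-⊓-≤ : ∀ {A : Set} (f : A → ℕ) b {l v} → v ∈ l → foldr (λ v acc → f v ⊓ acc) b l ≤ f v
foldr-⊓-≤ f b (here refl) = m⊓n≤m _ _
foldr-⊓-≤ f b (there v∈l) = ≤-trans (m⊓n≤n _ _) (foldr-⊓-≤ f b v∈l)

≤-foldr-⊓ : ∀ {A : Set} (f : A → ℕ) {b x} l → x ≤ b → (∀ v → x ≤ f v) →
            x ≤ foldr (λ v acc → f v ⊓ acc) b l
≤-foldr-⊓ f [] x≤b x≤f = x≤b
≤-foldr-⊓ f (v ∷ l) x≤b x≤f = ⊓-glb (x≤f v) (≤-foldr-⊓ f l x≤b x≤f)

φ-≤-Cdel : ∀ {n} (G : Graph (suc n)) S v → φ G S ≤ Cdel G S v
φ-≤-Cdel G S v = foldr-⊓-≤ (Cdel G S) _ (∈-allFin v)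

≤-φ : ∀ {n} (G : Graph (suc n)) S {x} → (∀ v → x ≤ Cdel G S v) → x ≤ φ G S
≤-φ G S x≤ = ≤-foldr-⊓ (Cdel G S) (allFin _) (x≤ zero) x≤

lemma26 : ∀ {n} (G : Graph (suc n)) (S : Cut (suc n)) (u w : Fin (suc n))
          → Stable G S
          → Critical G S u
          → (∀ v → Critical G S v → v ≡ u)
          → S u ≡ true
          → S w ≡ false
          → ExcessZero G S w
          → φ G (S ⊕ w) ≥ φ G S
lemma26 G S u w _ _ only-u-critical Su Sw balanced = ≤-φ G (S ⊕ w) bound
  where
  open ≤-Reasoning
  drop : ∀ {v} → v ≢ w → Cdel G S v ≤ Cdel G (S ⊕ w) v + 𝟙 (crosses G (S ⊕ w) v w)
  drop {v} v≢w = Cdel-≤-Cdel-+ G {S} {S ⊕ w} v _ (C-⊕ G S w balanced) (degS-⊕-≤ G S w v≢w)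
  bound : ∀ v → φ G S ≤ Cdel G (S ⊕ w) v
  bound v with v ≟ w | v ≟ u
  ... | yes refl | _ = ≤-trans (φ-≤-Cdel G S v) (≤-reflexive (≡.sym (Cdel-⊕-self G S v)))
  ... | no v≢w | yes refl = begin
    φ G S                                           ≤⟨ φ-≤-Cdel G S v ⟩
    Cdel G S v                                      ≤⟨ drop v≢w ⟩
    Cdel G (S ⊕ w) v + 𝟙 (crosses G (S ⊕ w) v w)  ≡⟨ cong (λ b → Cdel G (S ⊕ w) v + 𝟙 b) uw-uncut ⟩
    Cdel G (S ⊕ w) v + 0                            ≡⟨ +-identityʳ _ ⟩
    Cdel G (S ⊕ w) v                                ∎
    where
    uw-uncut : crosses G (S ⊕ w) v w ≡ false
    uw-uncut = crosses-⊕-opposite G S w v≢w (trans Su (≡.sym (cong not Sw)))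
  ... | no v≢w | no v≢u = m<1+n⇒m≤n (begin-strict
    φ G S                                           <⟨ ≤∧≢⇒< (φ-≤-Cdel G S v) (v≢u ∘ only-u-critical v ∘ ≡.sym) ⟩
    Cdel G S v                                      ≤⟨ drop v≢w ⟩
    Cdel G (S ⊕ w) v + 𝟙 (crosses G (S ⊕ w) v w)  ≤⟨ +-monoʳ-≤ _ (𝟙≤1 _) ⟩
    Cdel G (S ⊕ w) v + 1                            ≡⟨ +-comm _ 1 ⟩
    suc (Cdel G (S ⊕ w) v)                          ∎)
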